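{- There is an algorithm which, given two strings $S_1$ and $S_2$ over a finite alphabet $\Sigma$, with $n=|S_1|$, $m=|S_2|$, and an integer $k\ge 0$, computes the length $\max_{0\le i<n,\,0\le j<m}\phi(i,j)$ of a longest common substring of $S_1$ and $S_2$ with at most $k$ mismatches, together with starting positions of a pair of substrings of $S_1$ and $S_2$ attaining this length, in $O(nm)$ time and using $O(1)$ space (in addition to the input).
   Context: Strings are indexed from $0$; $S[a..b]$ denotes the substring $S[a]S[a+1]\cdots S[b]$. For $0\le i<n$ and $0\le j<m$, $\phi(i,j)$ is the largest integer $l\le \min(i,j)+1$ such that $|\{0\le h\le l-1 : S_1[i-h]\ne S_2[j-h]\}|\le k$, i.e. the length of the longest pair of substrings of $S_1$ and $S_2$ ending at positions $i$ and $j$ respectively whose Hamming distance is at most $k$. The longest common substring with $k$ mismatches problem asks for $\max_{i,j}\phi(i,j)$, i.e. the maximum length of substrings $A_1$ of $S_1$ and $A_2$ of $S_2$ with $|A_1|=|A_2|$ and Hamming distance between $A_1$ and $A_2$ at most $k$. Space is measured in machine words (integers of $O(\log(n+m))$ bits). -}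

module Defs where

open import Data.Nat using (ℕ; zero; suc; _+_; _∸_; _⊓_; _⊔_; _≤ᵇ_; _<ᵇ_; _≡ᵇ_)
open import Data.Bool using (Bool; true; false; if_then_else_)
open import Data.Fin using (Fin; zero; suc)
import Data.Fin as Fin
open import Data.List using (List; []; _∷_; length; foldr; upTo; map; concatMap)
open import Data.Vec using (Vec; []; _∷_; lookup; _[_]≔_; replicate)
open import Data.Maybe using (Maybe; just; nothing)
open import Data.Product using (Σ; _×_; _,_)
open import Relation.Binary.PropositionalEquality using (_≡_)
open import Data.Nat using (_≤_)
open import Relation.Nullary using (does)

Str : ℕ → Set
Str σ = List (Fin σ)

charAt : ∀ {σ} → Str σ → ℕ → Maybe (Fin σ)
charAt []       _       = nothing
charAt (c ∷ cs) zero    = just c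
charAt (c ∷ cs) (suc p) = charAt cs p

sameChar : ∀ {σ} → Maybe (Fin σ) → Maybe (Fin σ) → Bool
sameChar (just a) (just b) = does (a Fin.≟ b)
sameChar _        _        = false

mis : Bool → ℕ
mis true  = 0
mis false = 1

mismBack : ∀ {σ} → Str σ → Str σ → ℕ → ℕ → ℕ → ℕ
mismBack S1 S2 i j zero    = 0
mismBack S1 S2 i j (suc h) =
  mismBack S1 S2 i j h + mis (sameChar (charAt S1 (i ∸ h)) (charAt S2 (j ∸ h)))

-- largest l ≤ b with P l (returns 0 if none)
largestUpTo : ℕ → (ℕ → Bool) → ℕ
largestUpTo zero    P = 0
largestUpTo (suc b) P = if P (suc b) then suc b else largestUpTo b P

φ : ∀ {σ} → ℕ → Str σ → Str σ → ℕ → ℕ → ℕ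
φ k S1 S2 i j = largestUpTo (suc (i ⊓ j)) (λ l → mismBack S1 S2 i j l ≤ᵇ k)

maxφ : ∀ {σ} → ℕ → Str σ → Str σ → ℕ
maxφ k S1 S2 =
  foldr _⊔_ 0 (concatMap (λ i → map (λ j → φ k S1 S2 i j) (upTo (length S2)))
                         (upTo (length S1)))

hamFwd : ∀ {σ} → Str σ → Str σ → ℕ → ℕ → ℕ → ℕ
hamFwd S1 S2 a b zero    = 0
hamFwd S1 S2 a b (suc h) =
  hamFwd S1 S2 a b h + mis (sameChar (charAt S1 (a + h)) (charAt S2 (b + h)))

Correct : ∀ {σ} → ℕ → Str σ → Str σ → (len a b : ℕ) → Set
Correct k S1 S2 len a b =
  (len ≡ maxφ k S1 S2) × (a + len ≤ length S1) × (b + len ≤ length S2)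
  × (hamFwd S1 S2 a b len ≤ k)

-- Machine model: a word-RAM-like register machine with a FIXED number R
-- of registers (= O(1) words of working space) and read-only access to
-- the input strings.  Characters can only be compared for equality.
-- Registers hold naturals; since the only arithmetic is ±1, every value
-- is bounded by (largest input value + number of steps), i.e. fits in
-- O(log(n+m+k)) bits within the claimed time bound.

data Which : Set where
  one two : Which

data Instr (R : ℕ) : Set where
  inc dec clr : Fin R → Instr R
  mov  : Fin R → Fin R → Instr R
  jmp  : ℕ → Instr R
  jlt  : Fin R → Fin R → ℕ → Instr R
  jeq  : Fin R → Fin R → ℕ → Instr R
  jchr : Which → Fin R → Which → Fin R → ℕ → Instr R
  halt : Instr R

Program : ℕ → Set
Program R = List (Instr R)

fetch : ∀ {R} → Program R → ℕ → Instr R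
fetch []       _       = halt                -- running off the end halts
fetch (x ∷ xs) zero    = x
fetch (x ∷ xs) (suc p) = fetch xs p

module Machine {σ : ℕ} (S1 S2 : Str σ) where
  str : Which → Str σ
  str one = S1
  str two = S2

  Config : ℕ → Set
  Config R = ℕ × Vec ℕ R

  jumpIf : ∀ {R} → Bool → ℕ → ℕ → Vec ℕ R → Config R
  jumpIf true  t pc rs = t , rs
  jumpIf false t pc rs = suc pc , rs

  step : ∀ {R} → Instr R → ℕ → Vec ℕ R → Config R
  step (inc x)   pc rs = suc pc , (rs [ x ]≔ suc (lookup rs x))
  step (dec x)   pc rs = suc pc , (rs [ x ]≔ (lookup rs x ∸ 1))
  step (clr x)   pc rs = suc pc , (rs [ x ]≔ 0)
  step (mov x y) pc rs = suc pc , (rs [ x ]≔ lookup rs y)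
  step (jmp t)   pc rs = t , rs
  step (jlt x y t) pc rs = jumpIf (lookup rs x <ᵇ lookup rs y) t pc rs
  step (jeq x y t) pc rs = jumpIf (lookup rs x ≡ᵇ lookup rs y) t pc rs
  step (jchr w x w′ y t) pc rs =
    jumpIf (sameChar (charAt (str w) (lookup rs x)) (charAt (str w′) (lookup rs y))) t pc rs
  step halt      pc rs = pc , rs

  run : ∀ {R} → Program R → ℕ → Config R → Maybe (Vec ℕ R)
  run P fuel (pc , rs) with fetch P pc
  ... | halt = just rs
  run P zero       (pc , rs) | _ = nothing
  run P (suc fuel) (pc , rs) | i = run P fuel (step i pc rs)

initRegs : (r n m k : ℕ) → Vec ℕ (3 + r)
initRegs r n m k = n ∷ m ∷ k ∷ replicate r 0

SolvesWithin : ∀ {σ} (r : ℕ) → Program (3 + r) → (T : ℕ) → Str σ → Str σ → ℕ → Set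
SolvesWithin r P T S1 S2 k =
  Σ (Vec ℕ (3 + r)) λ out →
    (Machine.run S1 S2 P T (0 , initRegs r (length S1) (length S2) k) ≡ just out)
    × Correct k S1 S2 (lookup out zero) (lookup out (suc zero)) (lookup out (suc (suc zero)))

-- Scan the n + m - 1 diagonals (i0 + t, j0 + t), where i0 = 0 or j0 = 0, with a sliding
-- window: extend it by one position on the right, then drop positions on the left while it
-- has more than k mismatches. The window is then left-maximal, so its width is exactly φ at
-- its right end: a longer window ending there contains the last dropped one, which already
-- has more than k mismatches. The widest window seen thus has length max φ. Both ends of the
-- window only move forward, so a diagonal costs O(min(n, m)) steps and the scan O(nm), and
-- fourteen registers suffice.

module Submission where

open import Defs
open import Data.Nat using (ℕ; _+_; _*_; _≤_)
open import Data.List using (length)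
open import Data.Product using (Σ)

open import Data.Bool using (Bool; true; false; T)
open import Data.Empty using (⊥-elim)
open import Data.Fin using (Fin; zero; suc; #_)
open import Data.List using (List; []; _∷_; foldr; upTo; map)
open import Data.List.Membership.Propositional using (_∈_)
import Data.List.Membership.Propositional.Properties as ∈
open import Data.List.Relation.Unary.All using (All; []; _∷_)
import Data.List.Relation.Unary.All.Properties as All
open import Data.List.Relation.Unary.Any using (here; there)
open import Data.Maybe using (just)
open import Data.Nat using (zero; suc; _∸_; _⊓_; _⊔_; _<_; _≤ᵇ_; _<ᵇ_; _≡ᵇ_; z≤n; s≤s; s≤s⁻¹; z<s)
open import Data.Nat.Properties
open import Algebra.Properties.CommutativeSemigroup +-commutativeSemigroup using (x∙yz≈y∙xz)
open import Data.Nat.Tactic.RingSolver using (solve-∀)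
open import Data.Product using (_×_; _,_; ∃-syntax)
open import Data.Sum using (_⊎_; inj₁; inj₂)
import Data.Sum as Sum
open import Data.Unit using (tt)
open import Data.Vec using (Vec; []; _∷_; lookup)
open import Function using (_∘_)
open import Relation.Binary.PropositionalEquality
open import Relation.Nullary using (¬_)

foldr-⊔-lub : ∀ {b} (xs : List ℕ) → All (_≤ b) xs → foldr _⊔_ 0 xs ≤ b
foldr-⊔-lub []       []         = z≤n
foldr-⊔-lub (x ∷ xs) (x≤b ∷ xs≤b) = ⊔-lub x≤b (foldr-⊔-lub xs xs≤b)

∈⇒≤-foldr-⊔ : ∀ {x} (xs : List ℕ) → x ∈ xs → x ≤ foldr _⊔_ 0 xs
∈⇒≤-foldr-⊔ (y ∷ xs) (here refl) = m≤m⊔n y _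
∈⇒≤-foldr-⊔ (y ∷ xs) (there x∈xs) = ≤-trans (∈⇒≤-foldr-⊔ xs x∈xs) (m≤n⊔m y _)

largestUpTo-≤ : ∀ b P {x} → (∀ {l} → x < l → l ≤ b → ¬ T (P l)) → largestUpTo b P ≤ x
largestUpTo-≤ zero    P h = z≤n
largestUpTo-≤ (suc b) P h with P (suc b) in eq
... | true  = ≮⇒≥ λ x<1+b → h x<1+b ≤-refl (subst T (sym eq) tt)
... | false = largestUpTo-≤ b P λ x<l l≤b → h x<l (m≤n⇒m≤1+n l≤b)

largestUpTo-≥ : ∀ b P {l} → T (P l) → l ≤ b → l ≤ largestUpTo b P
largestUpTo-≥ zero    P _  z≤n = z≤n
largestUpTo-≥ (suc b) P Pl l≤1+b with P (suc b) in eq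
... | true  = l≤1+b
... | false with m≤n⇒m<n∨m≡n l≤1+b
...   | inj₁ (s≤s l≤b) = largestUpTo-≥ b P Pl l≤b
...   | inj₂ refl      = ⊥-elim (subst T eq Pl)

mis-T : ∀ {b} → T b → mis b ≡ 0
mis-T {true} _ = refl

mis-¬T : ∀ {b} → ¬ T b → mis b ≡ 1
mis-¬T {false} _  = refl
mis-¬T {true}  ¬t = ⊥-elim (¬t tt)

module Mismatches {σ : ℕ} (S1 S2 : Str σ) where

  same : ℕ → ℕ → Bool
  same a b = sameChar (charAt S1 a) (charAt S2 b)

  ham : ℕ → ℕ → ℕ → ℕ
  ham = hamFwd S1 S2

  ham-suc : ∀ a b l → ham a b (suc l) ≡ mis (same a b) + ham (suc a) (suc b) l
  ham-suc a b zero
    rewrite +-identityʳ a | +-identityʳ b = +-comm 0 _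
  ham-suc a b (suc l)
    rewrite ham-suc a b l | +-suc a l | +-suc b l = +-assoc (mis (same a b)) _ _

  mismBack-mono : ∀ i j {h h′} → h ≤ h′ → mismBack S1 S2 i j h ≤ mismBack S1 S2 i j h′
  mismBack-mono i j {h′ = zero}   z≤n  = z≤n
  mismBack-mono i j {h′ = suc h′} h≤1+h′ with m≤n⇒m<n∨m≡n h≤1+h′
  ... | inj₁ (s≤s h≤h′) = ≤-trans (mismBack-mono i j h≤h′) (m≤m+n _ _)
  ... | inj₂ refl       = ≤-refl

  mismBack≡ham : ∀ {i j} h a b → a + h ≡ suc i → b + h ≡ suc j → mismBack S1 S2 i j h ≡ ham a b h
  mismBack≡ham zero    a b _ _ = refl
  mismBack≡ham {i} {j} (suc h) a b a+1+h≡1+i b+1+h≡1+j = begin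
    mismBack S1 S2 i j h + mis (same (i ∸ h) (j ∸ h))
      ≡⟨ cong₂ _+_ (mismBack≡ham h (suc a) (suc b) (shift a a+1+h≡1+i) (shift b b+1+h≡1+j))
                   (cong₂ (λ x y → mis (same x y)) (start a a+1+h≡1+i) (start b b+1+h≡1+j)) ⟩
    ham (suc a) (suc b) h + mis (same a b)
      ≡⟨ +-comm _ (mis (same a b)) ⟩
    mis (same a b) + ham (suc a) (suc b) h
      ≡⟨ ham-suc a b h ⟨
    ham a b (suc h) ∎
    where
    open ≡-Reasoning
    shift : ∀ a {i} → a + suc h ≡ suc i → suc a + h ≡ suc i
    shift a eq = trans (sym (+-suc a h)) eq
    start : ∀ a {i} → a + suc h ≡ suc i → i ∸ h ≡ a
    start a eq = trans (cong (_∸ h) (suc-injective (sym (shift a eq)))) (m+n∸n≡m a h)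

diagonal-⊓ : ∀ {i0 j0} → i0 ≡ 0 ⊎ j0 ≡ 0 → ∀ t → (i0 + t) ⊓ (j0 + t) ≡ t
diagonal-⊓ {j0 = j0} (inj₁ refl) t = m≤n⇒m⊓n≡m (m≤n+m t j0)
diagonal-⊓ {i0 = i0} (inj₂ refl) t = m≥n⇒m⊓n≡n (m≤n+m t i0)

diagonal-point : ∀ {i0 j0 i j} → i0 ≡ 0 ⊎ j0 ≡ 0 → i0 + j ≡ i + j0 →
                 ∃[ t ] i ≡ i0 + t × j ≡ j0 + t
diagonal-point {j0 = j0} {i} (inj₁ refl) eq = i , refl , trans eq (+-comm i j0)
diagonal-point {i0} {j = j} (inj₂ refl) eq = j , sym (trans eq (+-identityʳ _)) , refl

module Windows {σ : ℕ} (S1 S2 : Str σ) (k : ℕ) where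
  open Mismatches S1 S2

  n m : ℕ
  n = length S1
  m = length S2

  φ′ : ℕ → ℕ → ℕ
  φ′ = φ k S1 S2

  φ-≥ : ∀ a b l → ham a b (suc l) ≤ k → suc l ≤ φ′ (a + l) (b + l)
  φ-≥ a b l ham≤k = largestUpTo-≥ _ _
    (≤⇒≤ᵇ (subst (_≤ k) (sym (mismBack≡ham (suc l) a b (+-suc a l) (+-suc b l))) ham≤k))
    (s≤s (⊓-glb (m≤n+m l a) (m≤n+m l b)))

  LeftMaximal : (i0 j0 s w : ℕ) → Set
  LeftMaximal i0 j0 s w = s ≡ 0 ⊎ ∃[ s′ ] s ≡ suc s′ × k < ham (i0 + s′) (j0 + s′) (suc w)

  φ-≤-width : ∀ {i0 j0 s w} t → i0 ≡ 0 ⊎ j0 ≡ 0 → suc t ≡ s + w → LeftMaximal i0 j0 s w →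
              φ′ (i0 + t) (j0 + t) ≤ w
  φ-≤-width {i0} {j0} {s} {w} t border 1+t≡s+w maximal
    rewrite diagonal-⊓ border t = largestUpTo-≤ (suc t) _ (too-long maximal)
    where
    too-long : LeftMaximal i0 j0 s w → ∀ {l} → w < l → l ≤ suc t →
               ¬ T (mismBack S1 S2 (i0 + t) (j0 + t) l ≤ᵇ k)
    too-long (inj₁ refl) w<l l≤1+t _ = <⇒≱ w<l (subst (_ ≤_) 1+t≡s+w l≤1+t)
    too-long (inj₂ (s′ , refl , k<ham)) {l} w<l _ mismBack≤k =
      <⇒≱ (<-≤-trans k<ham (let open ≤-Reasoning in begin
            ham (i0 + s′) (j0 + s′) (suc w)                ≡⟨ mismBack≡ham (suc w) _ _ (ends i0) (ends j0) ⟨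
            mismBack S1 S2 (i0 + t) (j0 + t) (suc w)       ≤⟨ mismBack-mono _ _ w<l ⟩
            mismBack S1 S2 (i0 + t) (j0 + t) l             ∎))
          (≤ᵇ⇒≤ _ _ mismBack≤k)
      where
      ends : ∀ x → x + s′ + suc w ≡ suc (x + t)
      ends x = begin
        x + s′ + suc w    ≡⟨ +-assoc x s′ (suc w) ⟩
        x + (s′ + suc w)  ≡⟨ cong (x +_) (+-suc s′ w) ⟩
        x + suc (s′ + w)  ≡⟨ +-suc x (s′ + w) ⟩
        suc (x + (s′ + w)) ≡⟨ cong (λ y → suc (x + y)) (suc-injective (sym 1+t≡s+w)) ⟩
        suc (x + t)       ∎
        where open ≡-Reasoning

  maxφ-≤ : ∀ {B} → (∀ {i j} → i < n → j < m → φ′ i j ≤ B) → maxφ k S1 S2 ≤ B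
  maxφ-≤ φ≤B = foldr-⊔-lub _ (All.concat⁺ (All.map⁺ (All.applyUpTo⁺₁ _ n λ i<n →
                 All.map⁺ (All.applyUpTo⁺₁ _ m λ j<m → φ≤B i<n j<m))))

  φ≤maxφ : ∀ {i j} → i < n → j < m → φ′ i j ≤ maxφ k S1 S2
  φ≤maxφ {i} i<n j<m = ∈⇒≤-foldr-⊔ _ (∈.∈-concat⁺′
    (∈.∈-map⁺ (φ′ i) (∈.∈-upTo⁺ j<m))
    (∈.∈-map⁺ (λ i → map (φ′ i) (upTo m)) (∈.∈-upTo⁺ i<n)))

  record Candidate (len a b : ℕ) : Set where
    field
      fits₁ : a + len ≤ n
      fits₂ : b + len ≤ m
      within-k : ham a b len ≤ k
  open Candidate

  Candidate⇒≤maxφ : ∀ {len a b} → Candidate len a b → len ≤ maxφ k S1 S2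
  Candidate⇒≤maxφ {zero}    _ = z≤n
  Candidate⇒≤maxφ {suc len} {a} {b} c = ≤-trans (φ-≥ a b len (within-k c))
    (φ≤maxφ (subst (_≤ n) (+-suc a len) (fits₁ c)) (subst (_≤ m) (+-suc b len) (fits₂ c)))

  Candidate⇒Correct : ∀ {len a b} → Candidate len a b → (∀ {i j} → i < n → j < m → φ′ i j ≤ len) →
                      Correct k S1 S2 len a b
  Candidate⇒Correct c φ≤len =
    ≤-antisym (Candidate⇒≤maxφ c) (maxφ-≤ φ≤len) , fits₁ c , fits₂ c , within-k c

module Execution {σ : ℕ} (S1 S2 : Str σ) {R : ℕ} (P : Program R) (Post : Vec ℕ R → Set) where
  open Machine S1 S2

  HaltsWithin : Config R → ℕ → Set
  HaltsWithin c t = ∀ fuel → ∃[ out ] run P (t + fuel) c ≡ just out × Post out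

  HaltsWithin-mono : ∀ c {t t′} → t ≤ t′ → HaltsWithin c t → HaltsWithin c t′
  HaltsWithin-mono c {t} {t′} t≤t′ halts fuel =
    subst (λ u → ∃[ out ] run P u c ≡ just out × Post out) extra≡ (halts (t′ ∸ t + fuel))
    where
    extra≡ : t + (t′ ∸ t + fuel) ≡ t′ + fuel
    extra≡ = trans (sym (+-assoc t _ fuel)) (cong (_+ fuel) (m+[n∸m]≡n t≤t′))

  HaltsWithin⇒run : ∀ {c t} → HaltsWithin c t → ∃[ out ] run P t c ≡ just out × Post out
  HaltsWithin⇒run {c} {t} halts =
    subst (λ u → ∃[ out ] run P u c ≡ just out × Post out) (+-identityʳ t) (halts 0)

  jumpIf-elim : ∀ b {target pc rs t} → (T b → HaltsWithin (target , rs) t) →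
                (¬ T b → HaltsWithin (suc pc , rs) t) → HaltsWithin (jumpIf b target pc rs) t
  jumpIf-elim true  taken _         = taken tt
  jumpIf-elim false _     not-taken = not-taken λ ()

rBest rBestI rBestJ rN rM rK rI0 rJ0 rEndI rEndJ rStartI rStartJ rMism rWidth : Fin 14
rBest = # 0 ; rBestI = # 1 ; rBestJ = # 2
rN = # 3 ; rM = # 4 ; rK = # 5
rI0 = # 6 ; rJ0 = # 7
rEndI = # 8 ; rEndJ = # 9 ; rStartI = # 10 ; rStartJ = # 11
rMism = # 12 ; rWidth = # 13

-- Jump targets are absolute addresses; each block is headed by its address.
prog : Program 14
prog =
  -- 0: save n, m, k; best := (0, 0, 0); first diagonal starts at (n - 1, 0)
    mov rN rBest ∷ mov rM rBestI ∷ mov rK rBestJ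
  ∷ clr rBest ∷ clr rBestI ∷ clr rBestJ
  ∷ mov rI0 rN ∷ dec rI0
  -- 8: empty window at the start of the diagonal
  ∷ mov rEndI rI0 ∷ mov rEndJ rJ0 ∷ mov rStartI rI0 ∷ mov rStartJ rJ0
  ∷ clr rMism ∷ clr rWidth
  -- 14: extend the window to the right
  ∷ jeq rEndI rN 35 ∷ jeq rEndJ rM 35
  ∷ jchr one rEndI two rEndJ 18 ∷ inc rMism
  ∷ inc rEndI ∷ inc rEndJ ∷ inc rWidth
  -- 21: shrink it from the left while it has more than k mismatches
  ∷ jlt rK rMism 23 ∷ jmp 29
  ∷ jchr one rStartI two rStartJ 25 ∷ dec rMism
  ∷ inc rStartI ∷ inc rStartJ ∷ dec rWidth ∷ jmp 21
  -- 29: keep it if it is the longest so far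
  ∷ jlt rBest rWidth 31 ∷ jmp 14
  ∷ mov rBest rWidth ∷ mov rBestI rStartI ∷ mov rBestJ rStartJ ∷ jmp 14
  -- 35: next diagonal: (i0 - 1, 0) while i0 > 0, then (0, j0 + 1) until j0 + 1 = m
  ∷ jlt rJ0 rI0 39 ∷ inc rJ0 ∷ jeq rJ0 rM 41 ∷ jmp 8
  ∷ dec rI0 ∷ jmp 8
  -- 41
  ∷ halt ∷ []

sweep-cost-≤ : ∀ {n m} → 1 ≤ n → 1 ≤ m → 8 + (n ∸ 1 + m) * (12 + (n ⊓ m) * 21) ≤ 74 * (n * m)
sweep-cost-≤ {n@(suc a)} {m@(suc b)} _ _ = begin
  8 + (a + m) * (12 + (n ⊓ m) * 21)
    ≤⟨ +-monoʳ-≤ 8 (*-monoˡ-≤ _ (+-monoˡ-≤ m (n≤1+n a))) ⟩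
  8 + (n + m) * (12 + (n ⊓ m) * 21)
    ≡⟨ cong (8 +_) (distrib (n + m) (n ⊓ m)) ⟩
  8 + ((n + m) * 12 + (n + m) * (n ⊓ m) * 21)
    ≤⟨ +-mono-≤ (*-monoʳ-≤ 8 (s≤s z≤n)) (+-mono-≤ (*-monoˡ-≤ 12 sum≤) (*-monoˡ-≤ 21 sum*min≤)) ⟩
  8 * (n * m) + ((n * m + n * m) * 12 + (n * m + n * m) * 21)
    ≡⟨ collect (n * m) ⟩
  74 * (n * m) ∎
  where
  open ≤-Reasoning
  distrib : ∀ s t → s * (12 + t * 21) ≡ s * 12 + s * t * 21
  distrib = solve-∀
  collect : ∀ p → 8 * p + ((p + p) * 12 + (p + p) * 21) ≡ 74 * p
  collect = solve-∀
  sum≤ : n + m ≤ n * m + n * m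
  sum≤ = +-mono-≤ (m≤m*n n m) (m≤n*m m n)
  sum*min≤ : (n + m) * (n ⊓ m) ≤ n * m + n * m
  sum*min≤ = begin
    (n + m) * (n ⊓ m)          ≡⟨ *-distribʳ-+ (n ⊓ m) n m ⟩
    n * (n ⊓ m) + m * (n ⊓ m)  ≤⟨ +-mono-≤ (*-monoʳ-≤ n (m⊓n≤n n m)) (*-monoʳ-≤ m (m⊓n≤m n m)) ⟩
    n * m + m * n              ≡⟨ cong (n * m +_) (*-comm m n) ⟩
    n * m + n * m              ∎

module Sweep {σ : ℕ} (S1 S2 : Str σ) (k : ℕ) where
  open Mismatches S1 S2
  open Windows S1 S2 k
  open Machine S1 S2

  record Vars : Set where
    field best bestI bestJ endI endJ startI startJ mism width : ℕ
  open Vars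

  regs : (i0 j0 : ℕ) → Vars → Vec ℕ 14
  regs i0 j0 v = best v ∷ bestI v ∷ bestJ v ∷ n ∷ m ∷ k ∷ i0 ∷ j0
               ∷ endI v ∷ endJ v ∷ startI v ∷ startJ v ∷ mism v ∷ width v ∷ []

  emptyAt : (i0 j0 : ℕ) → Vars → Vars
  emptyAt i0 j0 v = record v
    { endI = i0 ; endJ = j0 ; startI = i0 ; startJ = j0 ; mism = 0 ; width = 0 }

  extended : Vars → ℕ → Vars
  extended v c = record v
    { endI = suc (endI v) ; endJ = suc (endJ v) ; mism = c ; width = suc (width v) }

  shrunk : Vars → ℕ → Vars
  shrunk v c = record v
    { startI = suc (startI v) ; startJ = suc (startJ v) ; mism = c ; width = width v ∸ 1 }

  withBest : Vars → (len a b : ℕ) → Vars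
  withBest v len a b = record v { best = len ; bestI = a ; bestJ = b }

  BestCandidate : Vars → Set
  BestCandidate v = Candidate (best v) (bestI v) (bestJ v)

  BoundedBefore BoundedThrough : (i0 j0 B : ℕ) → Set
  BoundedBefore  i0 j0 B = ∀ {i j} → i < n → j < m → i0 + j < i + j0 → φ′ i j ≤ B
  BoundedThrough i0 j0 B = ∀ {i j} → i < n → j < m → i0 + j ≤ i + j0 → φ′ i j ≤ B

  -- The window covers offsets s, …, s + width - 1 of the diagonal through (i0, j0) and can
  -- be extended ℓ more times. Right after an extension (pending = 1) the φ-value at its new
  -- right end is not yet accounted for by best.
  record Inv (i0 j0 pending s ℓ : ℕ) (v : Vars) : Set where
    field
      startI≡ : startI v ≡ i0 + s
      startJ≡ : startJ v ≡ j0 + s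
      endI≡ : endI v ≡ startI v + width v
      endJ≡ : endJ v ≡ startJ v + width v
      roomI : endI v + ℓ ≤ n
      roomJ : endJ v + ℓ ≤ m
      tight : endI v + ℓ ≡ n ⊎ endJ v + ℓ ≡ m
      mism≡ : mism v ≡ ham (startI v) (startJ v) (width v)
      maximal : LeftMaximal i0 j0 s (width v)
      swept : ∀ {t} → pending + t < s + width v → φ′ (i0 + t) (j0 + t) ≤ best v
      before : BoundedBefore i0 j0 (best v)
      candidate : BestCandidate v
  open Inv

  start-Inv : ∀ {i0 j0 v} → i0 < n → j0 < m → BoundedBefore i0 j0 (best v) →
              BestCandidate v →
              Inv i0 j0 0 0 ((n ∸ i0) ⊓ (m ∸ j0)) (emptyAt i0 j0 v)
  start-Inv {i0} {j0} i0<n j0<m bounded cand = record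
    { startI≡ = sym (+-identityʳ i0)
    ; startJ≡ = sym (+-identityʳ j0)
    ; endI≡ = sym (+-identityʳ i0)
    ; endJ≡ = sym (+-identityʳ j0)
    ; roomI = ≤-trans (+-monoʳ-≤ i0 (m⊓n≤m _ _)) (≤-reflexive (m+[n∸m]≡n (<⇒≤ i0<n)))
    ; roomJ = ≤-trans (+-monoʳ-≤ j0 (m⊓n≤n _ _)) (≤-reflexive (m+[n∸m]≡n (<⇒≤ j0<m)))
    ; tight = tight′
    ; mism≡ = refl
    ; maximal = inj₁ refl
    ; swept = λ ()
    ; before = bounded
    ; candidate = cand
    }
    where
    tight′ : i0 + (n ∸ i0) ⊓ (m ∸ j0) ≡ n ⊎ j0 + (n ∸ i0) ⊓ (m ∸ j0) ≡ m
    tight′ with ≤-total (n ∸ i0) (m ∸ j0)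
    ... | inj₁ ≤ = inj₁ (trans (cong (i0 +_) (m≤n⇒m⊓n≡m ≤)) (m+[n∸m]≡n (<⇒≤ i0<n)))
    ... | inj₂ ≥ = inj₂ (trans (cong (j0 +_) (m≥n⇒m⊓n≡n ≥)) (m+[n∸m]≡n (<⇒≤ j0<m)))

  extend-Inv : ∀ {i0 j0 s ℓ v} c → Inv i0 j0 0 s (suc ℓ) v →
               c ≡ mism v + mis (same (endI v) (endJ v)) → Inv i0 j0 1 s ℓ (extended v c)
  extend-Inv {i0} {j0} {s} {ℓ} {v} c iv c≡ = record
    { startI≡ = startI≡ iv
    ; startJ≡ = startJ≡ iv
    ; endI≡ = trans (cong suc (endI≡ iv)) (sym (+-suc (startI v) (width v)))
    ; endJ≡ = trans (cong suc (endJ≡ iv)) (sym (+-suc (startJ v) (width v)))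
    ; roomI = subst (_≤ n) (+-suc (endI v) ℓ) (roomI iv)
    ; roomJ = subst (_≤ m) (+-suc (endJ v) ℓ) (roomJ iv)
    ; tight = Sum.map (trans (sym (+-suc (endI v) ℓ))) (trans (sym (+-suc (endJ v) ℓ))) (tight iv)
    ; mism≡ = trans c≡ (cong₂ _+_ (mism≡ iv) (cong₂ (λ a b → mis (same a b)) (endI≡ iv) (endJ≡ iv)))
    ; maximal = longer (maximal iv)
    ; swept = λ {t} 2+t≤s+1+w →
        swept iv (s≤s⁻¹ (subst (suc (suc t) ≤_) (+-suc s (width v)) 2+t≤s+1+w))
    ; before = before iv
    ; candidate = candidate iv
    }
    where
    longer : ∀ {w} → LeftMaximal i0 j0 s w → LeftMaximal i0 j0 s (suc w)
    longer (inj₁ s≡0)                = inj₁ s≡0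
    longer (inj₂ (s′ , s≡ , k<ham)) = inj₂ (s′ , s≡ , <-≤-trans k<ham (m≤m+n _ _))

  shrink-Inv : ∀ {i0 j0 s ℓ v} c → Inv i0 j0 1 s ℓ v → k < mism v →
               mism v ≡ mis (same (startI v) (startJ v)) + c → Inv i0 j0 1 (suc s) ℓ (shrunk v c)
  shrink-Inv {i0} {j0} {s} {ℓ} {v} c iv k<mism mism≡′ = record
    { startI≡ = trans (cong suc (startI≡ iv)) (sym (+-suc i0 s))
    ; startJ≡ = trans (cong suc (startJ≡ iv)) (sym (+-suc j0 s))
    ; endI≡ = trans (endI≡ iv) (trans (cong (startI v +_) width≡) (+-suc _ _))
    ; endJ≡ = trans (endJ≡ iv) (trans (cong (startJ v +_) width≡) (+-suc _ _))
    ; roomI = roomI iv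
    ; roomJ = roomJ iv
    ; tight = tight iv
    ; mism≡ = +-cancelˡ-≡ _ _ _ (begin
        mis (same (startI v) (startJ v)) + c        ≡⟨ mism≡′ ⟨
        mism v                                       ≡⟨ ham-width ⟩
        ham (startI v) (startJ v) (suc (width v ∸ 1)) ≡⟨ ham-suc _ _ _ ⟩
        mis (same (startI v) (startJ v)) + ham (suc (startI v)) (suc (startJ v)) (width v ∸ 1) ∎)
    ; maximal = inj₂ (s , refl , subst (k <_) (trans ham-width (cong₂ (λ a b → ham a b (suc (width v ∸ 1)))
                                                                      (startI≡ iv) (startJ≡ iv))) k<mism)
    ; swept = λ {t} 2+t≤1+s+w → swept iv (subst (suc (suc t) ≤_) s+w≡ 2+t≤1+s+w)
    ; before = before iv
    ; candidate = candidate iv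
    }
    where
    open ≡-Reasoning
    width≡ : width v ≡ suc (width v ∸ 1)
    width≡ = sym (m+[n∸m]≡n (n≢0⇒n>0 λ w≡0 →
      <⇒≱ k<mism (subst (_≤ k) (sym (trans (mism≡ iv) (cong (ham _ _) w≡0))) z≤n)))
    ham-width : mism v ≡ ham (startI v) (startJ v) (suc (width v ∸ 1))
    ham-width = trans (mism≡ iv) (cong (ham _ _) width≡)
    s+w≡ : suc s + (width v ∸ 1) ≡ s + width v
    s+w≡ = trans (sym (+-suc s _)) (cong (s +_) (sym width≡))

  window-Candidate : ∀ {i0 j0 p s ℓ v} → Inv i0 j0 p s ℓ v → mism v ≤ k →
                     Candidate (width v) (startI v) (startJ v)
  window-Candidate {ℓ = ℓ} {v} iv mism≤k = record
    { fits₁ = subst (_≤ n) (endI≡ iv) (≤-trans (m≤m+n (endI v) ℓ) (roomI iv))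
    ; fits₂ = subst (_≤ m) (endJ≡ iv) (≤-trans (m≤m+n (endJ v) ℓ) (roomJ iv))
    ; within-k = subst (_≤ k) (mism≡ iv) mism≤k
    }

  settle-Inv : ∀ {i0 j0 s ℓ v} → i0 ≡ 0 ⊎ j0 ≡ 0 → Inv i0 j0 1 s ℓ v →
               ∀ {len a b} → Candidate len a b → best v ≤ len → width v ≤ len →
               Inv i0 j0 0 s ℓ (withBest v len a b)
  settle-Inv {i0} {j0} {s} {ℓ} {v} border iv {len} cand best≤len width≤len = record
    { startI≡ = startI≡ iv
    ; startJ≡ = startJ≡ iv
    ; endI≡ = endI≡ iv
    ; endJ≡ = endJ≡ iv
    ; roomI = roomI iv
    ; roomJ = roomJ iv
    ; tight = tight iv
    ; mism≡ = mism≡ iv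
    ; maximal = maximal iv
    ; swept = swept′
    ; before = λ i<n j<m earlier → ≤-trans (before iv i<n j<m earlier) best≤len
    ; candidate = cand
    }
    where
    swept′ : ∀ {t} → t < s + width v → φ′ (i0 + t) (j0 + t) ≤ len
    swept′ {t} t<s+w with m≤n⇒m<n∨m≡n t<s+w
    ... | inj₁ 1+t<s+w = ≤-trans (swept iv 1+t<s+w) best≤len
    ... | inj₂ 1+t≡s+w = ≤-trans (φ-≤-width t border 1+t≡s+w (maximal iv)) width≤len

  leave-Inv : ∀ {i0 j0 s ℓ v} → i0 ≡ 0 ⊎ j0 ≡ 0 → Inv i0 j0 0 s ℓ v →
              endI v ≡ n ⊎ endJ v ≡ m → BoundedThrough i0 j0 (best v)
  leave-Inv {i0} {j0} {s} {ℓ} {v} border iv at-end {i} {j} i<n j<m i0+j≤i+j0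
    with m≤n⇒m<n∨m≡n i0+j≤i+j0
  ... | inj₁ earlier = before iv i<n j<m earlier
  ... | inj₂ same-diagonal with diagonal-point border same-diagonal
  ...   | t , refl , refl = swept iv (t<end at-end)
    where
    end≡ : ∀ {x y} → y ≡ x + s → ∀ {e} → e ≡ y + width v → e ≡ x + (s + width v)
    end≡ {x} y≡ e≡ = trans e≡ (trans (cong (_+ width v) y≡) (+-assoc x s (width v)))
    t<end : endI v ≡ n ⊎ endJ v ≡ m → t < s + width v
    t<end (inj₁ endI≡n) = +-cancelˡ-< i0 t _
      (subst (i0 + t <_) (trans (sym endI≡n) (end≡ (startI≡ iv) (endI≡ iv))) i<n)
    t<end (inj₂ endJ≡m) = +-cancelˡ-< j0 t _
      (subst (j0 + t <_) (trans (sym endJ≡m) (end≡ (startJ≡ iv) (endJ≡ iv))) j<m)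

  Answer : Vec ℕ 14 → Set
  Answer out =
    Correct k S1 S2 (lookup out zero) (lookup out (suc zero)) (lookup out (suc (suc zero)))

  open Execution S1 S2 prog Answer

  module Diagonal (i0 j0 : ℕ) (border : i0 ≡ 0 ⊎ j0 ≡ 0) (Y : ℕ)
    (next : ∀ {v} → BestCandidate v → BoundedThrough i0 j0 (best v) →
            HaltsWithin (35 , regs i0 j0 v) Y) where

    -- Each remaining extension pays for itself, its settling and one later
    -- shrink step; each position in the window pays for one shrink step.
    budget : (ℓ w : ℕ) → ℕ
    budget ℓ w = ℓ * 21 + (w * 7 + Y)

    budget-suc : ∀ ℓ w → budget ℓ (suc w) ≡ 7 + budget ℓ w
    budget-suc ℓ w = x∙yz≈y∙xz (ℓ * 21) 7 (w * 7 + Y)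

    Y≤budget : ∀ ℓ w → Y ≤ budget ℓ w
    Y≤budget ℓ w = ≤-trans (m≤n+m Y (w * 7)) (m≤n+m _ (ℓ * 21))

    AtLoop : ℕ → Set
    AtLoop ℓ = ∀ {s v} → Inv i0 j0 0 s ℓ v → mism v ≤ k →
               HaltsWithin (14 , regs i0 j0 v) (2 + budget ℓ (width v))

    settle : ∀ {ℓ} → AtLoop ℓ → ∀ {s v} → Inv i0 j0 1 s ℓ v → mism v ≤ k →
             HaltsWithin (29 , regs i0 j0 v) (7 + budget ℓ (width v))
    settle loop {v = v} iv mism≤k = jumpIf-elim (best v <ᵇ width v)
      (λ better → loop
        (settle-Inv border iv (window-Candidate iv mism≤k) (<⇒≤ (<ᵇ⇒< _ _ better)) ≤-refl) mism≤k)
      (λ not-better → HaltsWithin-mono (14 , regs i0 j0 v) (m≤n+m _ 3) (loop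
        (settle-Inv border iv (candidate iv) ≤-refl (≮⇒≥ (not-better ∘ <⇒<ᵇ))) mism≤k))

    shrink : ∀ {ℓ} → AtLoop ℓ → ∀ w {s v} → width v ≡ w → Inv i0 j0 1 s ℓ v →
             HaltsWithin (21 , regs i0 j0 v) (9 + budget ℓ w)
    drop-left : ∀ {ℓ} → AtLoop ℓ → ∀ w {s v} → width v ≡ w → Inv i0 j0 1 s ℓ v → k < mism v →
                HaltsWithin (23 , regs i0 j0 v) (8 + budget ℓ w)

    shrink {ℓ} loop w {v = v} w≡ iv = jumpIf-elim (k <ᵇ mism v)
      (λ over → drop-left loop w w≡ iv (<ᵇ⇒< _ _ over))
      (λ not-over → subst (λ x → HaltsWithin (22 , regs i0 j0 v) (8 + budget ℓ x)) w≡
        (settle loop iv (≮⇒≥ (not-over ∘ <⇒<ᵇ))))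

    drop-left loop zero w≡ iv k<mism =
      ⊥-elim (<⇒≱ k<mism (subst (_≤ k) (sym (trans (mism≡ iv) (cong (ham _ _) w≡))) z≤n))
    drop-left {ℓ} loop (suc w) {v = v} w≡ iv k<mism rewrite budget-suc ℓ w =
      jumpIf-elim (same (startI v) (startJ v))
        (λ matched → HaltsWithin-mono (21 , regs i0 j0 (shrunk v (mism v))) (n≤1+n _)
          (continue (mism v) (cong (_+ mism v) (sym (mis-T matched)))))
        (λ mismatched → continue (mism v ∸ 1)
          (trans (sym (m+[n∸m]≡n (≤-trans (s≤s z≤n) k<mism)))
                 (cong (_+ (mism v ∸ 1)) (sym (mis-¬T mismatched)))))
      where
      continue : ∀ c → mism v ≡ mis (same (startI v) (startJ v)) + c →
                 HaltsWithin (21 , regs i0 j0 (shrunk v c)) (9 + budget ℓ w)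
      continue c mism≡′ = shrink loop w (cong (_∸ 1) w≡) (shrink-Inv c iv k<mism mism≡′)

    loop : ∀ ℓ → AtLoop ℓ
    loop ℓ {v = v} iv mism≤k = jumpIf-elim (endI v ≡ᵇ n)
      (λ at-n → HaltsWithin-mono (35 , regs i0 j0 v) (≤-trans (Y≤budget ℓ (width v)) (n≤1+n _))
        (leave (inj₁ (≡ᵇ⇒≡ _ _ at-n))))
      (λ not-n → jumpIf-elim (endJ v ≡ᵇ m)
        (λ at-m → HaltsWithin-mono (35 , regs i0 j0 v) (Y≤budget ℓ (width v))
          (leave (inj₂ (≡ᵇ⇒≡ _ _ at-m))))
        (λ not-m → extend ℓ iv not-n not-m))
      where
      leave : endI v ≡ n ⊎ endJ v ≡ m → HaltsWithin (35 , regs i0 j0 v) Y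
      leave at-end = next (candidate iv) (leave-Inv border iv at-end)
      extend : ∀ ℓ {s} → Inv i0 j0 0 s ℓ v → ¬ T (endI v ≡ᵇ n) → ¬ T (endJ v ≡ᵇ m) →
               HaltsWithin (16 , regs i0 j0 v) (budget ℓ (width v))
      extend zero iv′ not-n not-m = ⊥-elim (Sum.[ not-n ∘ ≡⇒≡ᵇ _ _ ∘ trans (sym (+-identityʳ _))
                                                , not-m ∘ ≡⇒≡ᵇ _ _ ∘ trans (sym (+-identityʳ _))
                                                ] (tight iv′))
      extend (suc ℓ′) iv′ _ _ = jumpIf-elim (same (endI v) (endJ v))
        (λ matched → HaltsWithin-mono (21 , regs i0 j0 (extended v (mism v))) (n≤1+n _)
          (continue (mism v) (sym (trans (cong (mism v +_) (mis-T matched)) (+-identityʳ _)))))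
        (λ mismatched → continue (suc (mism v))
          (sym (trans (cong (mism v +_) (mis-¬T mismatched)) (+-comm _ 1))))
        where
        continue : ∀ c → c ≡ mism v + mis (same (endI v) (endJ v)) →
                   HaltsWithin (21 , regs i0 j0 (extended v c)) (16 + budget ℓ′ (width v))
        continue c c≡ = subst (λ x → HaltsWithin (21 , regs i0 j0 (extended v c)) (9 + x))
          (budget-suc ℓ′ (width v)) (shrink (loop ℓ′) (suc (width v)) refl (extend-Inv c iv′ c≡))

  per-diagonal : ℕ
  per-diagonal = 12 + (n ⊓ m) * 21

  -- K counts the diagonals still to be processed, the one through (i0, j0) included.
  Sweeps : ℕ → Set
  Sweeps K = ∀ {i0 j0} → K + j0 ≡ i0 + m → i0 ≡ 0 ⊎ j0 ≡ 0 → i0 < n → j0 < m →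
             ∀ {v} → BestCandidate v → BoundedBefore i0 j0 (best v) →
             HaltsWithin (8 , regs i0 j0 v) (K * per-diagonal)

  lower-i0 : ∀ K → Sweeps K →
             ∀ {i0 j0} → suc K + j0 ≡ i0 + m → j0 ≡ 0 → j0 < i0 → i0 < n → j0 < m →
             ∀ {v} → BestCandidate v → BoundedThrough i0 j0 (best v) →
             HaltsWithin (39 , regs i0 j0 v) (3 + K * per-diagonal)
  lower-i0 K sweep {zero}   _  refl () _ _
  lower-i0 K sweep {suc i0} K≡ refl _ i0<n j0<m {v} cand bounded =
    HaltsWithin-mono (8 , regs i0 0 v) {K * per-diagonal} (n≤1+n _)
      (sweep (suc-injective K≡) (inj₂ refl) (<-trans (n<1+n i0) i0<n) j0<m {v} cand bounded)

  raise-j0 : ∀ K → Sweeps K →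
             ∀ {i0 j0} → suc K + j0 ≡ i0 + m → i0 ≡ 0 → i0 < n → j0 < m →
             ∀ {v} → BestCandidate v → BoundedThrough i0 j0 (best v) →
             HaltsWithin (36 , regs i0 j0 v) (3 + K * per-diagonal)
  raise-j0 K sweep {j0 = j0} K≡ refl i0<n j0<m {v} cand bounded = jumpIf-elim (suc j0 ≡ᵇ m)
    (λ last → HaltsWithin-mono (41 , regs 0 (suc j0) v) {0} {1 + K * per-diagonal} z≤n λ _ →
      regs 0 (suc j0) v , refl , Candidate⇒Correct cand λ {i} {j} i<n j<m →
        bounded i<n j<m (≤-trans (≤-pred (subst (j <_) (sym (≡ᵇ⇒≡ _ _ last)) j<m)) (m≤n+m j0 i)))
    (λ not-last → sweep (trans (+-suc K j0) K≡) (inj₁ refl) i0<n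
      (≤∧≢⇒< j0<m (not-last ∘ ≡⇒≡ᵇ _ _)) {v} cand
      λ {i} {j} i<n j<m j<i+1+j0 → bounded i<n j<m (≤-pred (subst (j <_) (+-suc i j0) j<i+1+j0)))

  next-diagonal : ∀ K → Sweeps K →
                  ∀ {i0 j0} → suc K + j0 ≡ i0 + m → i0 ≡ 0 ⊎ j0 ≡ 0 → i0 < n → j0 < m →
                  ∀ {v} → BestCandidate v → BoundedThrough i0 j0 (best v) →
                  HaltsWithin (35 , regs i0 j0 v) (4 + K * per-diagonal)
  next-diagonal K sweep {i0} {j0} K≡ border i0<n j0<m {v} cand bounded = jumpIf-elim (j0 <ᵇ i0)
    (λ j0<i0 → let j0<i0 = <ᵇ⇒< _ _ j0<i0 in
      lower-i0 K sweep K≡ (j0≡0 border j0<i0) j0<i0 i0<n j0<m {v} cand bounded)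
    (λ j0≮i0 → raise-j0 K sweep K≡ (i0≡0 border (j0≮i0 ∘ <⇒<ᵇ)) i0<n j0<m {v} cand bounded)
    where
    j0≡0 : i0 ≡ 0 ⊎ j0 ≡ 0 → j0 < i0 → j0 ≡ 0
    j0≡0 (inj₁ refl) ()
    j0≡0 (inj₂ j0≡0) _ = j0≡0
    i0≡0 : i0 ≡ 0 ⊎ j0 ≡ 0 → ¬ j0 < i0 → i0 ≡ 0
    i0≡0 (inj₁ i0≡0) _ = i0≡0
    i0≡0 (inj₂ refl) j0≮i0 = n≤0⇒n≡0 (≮⇒≥ j0≮i0)

  sweep : ∀ K → Sweeps K
  sweep zero {i0} K≡ _ _ j0<m _ _ = ⊥-elim (<⇒≱ j0<m (≤-trans (m≤n+m m i0) (≤-reflexive (sym K≡))))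
  sweep (suc K) {i0} {j0} K≡ border i0<n j0<m {v} cand bounded =
    HaltsWithin-mono (14 , regs i0 j0 (emptyAt i0 j0 v)) budget≤
      (Diagonal.loop i0 j0 border (4 + K * per-diagonal)
        (next-diagonal K (sweep K) K≡ border i0<n j0<m) ℓ (start-Inv {v = v} i0<n j0<m bounded cand) z≤n)
    where
    ℓ = (n ∸ i0) ⊓ (m ∸ j0)
    budget≤ : 2 + (ℓ * 21 + (4 + K * per-diagonal)) ≤ 6 + ((n ⊓ m) * 21 + K * per-diagonal)
    budget≤ = ≤-trans (≤-reflexive (cong (2 +_) (x∙yz≈y∙xz (ℓ * 21) 4 _)))
      (+-monoʳ-≤ 6 (+-monoˡ-≤ _ (*-monoˡ-≤ 21 (⊓-mono-≤ (m∸n≤m n i0) (m∸n≤m m j0)))))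

  start : 1 ≤ n → 1 ≤ m → HaltsWithin (0 , initRegs 11 n m k) (8 + (n ∸ 1 + m) * per-diagonal)
  start 1≤n 1≤m = sweep (n ∸ 1 + m) (+-identityʳ _) (inj₂ refl) (∸-monoʳ-< z<s 1≤n) 1≤m
    {v = record { best = 0 ; bestI = 0 ; bestJ = 0 ; endI = 0 ; endJ = 0
                ; startI = 0 ; startJ = 0 ; mism = 0 ; width = 0 }}
    (record { fits₁ = z≤n ; fits₂ = z≤n ; within-k = z≤n })
    λ {i} {j} i<n _ before → ⊥-elim (<⇒≱ before
      (≤-trans (≤-reflexive (+-identityʳ i)) (≤-trans (<⇒≤pred i<n) (m≤m+n _ j))))

  prog-solves : 1 ≤ n → 1 ≤ m → SolvesWithin 11 prog (74 * (n * m)) S1 S2 k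
  prog-solves 1≤n 1≤m = HaltsWithin⇒run {initial} {74 * (n * m)}
    (HaltsWithin-mono initial {8 + (n ∸ 1 + m) * per-diagonal}
      (sweep-cost-≤ 1≤n 1≤m) (start 1≤n 1≤m))
    where
    initial : Config 14
    initial = 0 , initRegs 11 n m k

mainTheorem1 : (σ : ℕ) →
    Σ ℕ λ r → Σ (Program (3 + r)) λ P → Σ ℕ λ C →
    (S1 S2 : Str σ) (k : ℕ) → 1 ≤ length S1 → 1 ≤ length S2 →
    SolvesWithin r P (C * (length S1 * length S2)) S1 S2 k
mainTheorem1 σ = 11 , prog , 74 , Sweep.prog-solves
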